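{- Let $G$ be a finite simple connected graph with a closed labeling $V(G)=[n]$, and for $N\ge0$ let $L_N=\{i\in[n]\mid d(i,1)=N\}$. Then: (1) Each $L_N$ is complete (any two distinct vertices of $L_N$ are adjacent). (2) If $L_N\neq\emptyset$ and $d=\max L_N$, then $L_{N+1}=N_G^>(d)$.
   Context: A labeling is a bijection $V(G)\to[n]$, identified with $V(G)=[n]$. It is closed if whenever $\{j,i\},\{i,k\}$ are distinct edges with either ($j>i$ and $k>i$) or ($j<i$ and $k<i$), then $\{j,k\}\in E(G)$. $d(i,j)$ is shortest-path distance in $G$. $N_G^>(i)=\{j\mid \{i,j\}\in E(G),\ j>i\}$. -}

module Defs where

open import Data.Nat using (ℕ; zero; suc)
import Data.Nat as ℕ
open import Data.Fin using (Fin; _<_)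
open import Data.Product using (_×_; ∃)
open import Relation.Binary.PropositionalEquality using (_≡_; _≢_)
open import Relation.Nullary using (¬_)
open import Data.Sum using (_⊎_)
import Data.Fin as Fin

-- A finite simple graph on the vertex set Fin n (vertex k of Fin n is the label k+1 of [n]).
record SimpleGraph (n : ℕ) : Set₁ where
  field
    Adj     : Fin n → Fin n → Set
    sym     : ∀ {i j} → Adj i j → Adj j i
    irrefl  : ∀ {i} → ¬ Adj i i
open SimpleGraph public

data Walk {n : ℕ} (G : SimpleGraph n) : Fin n → Fin n → ℕ → Set where
  here : ∀ {i} → Walk G i i zero
  step : ∀ {i j k m} → Adj G i j → Walk G j k m → Walk G i k (ℕ.suc m)

Connected : ∀ {n} → SimpleGraph n → Set
Connected G = ∀ i j → ∃ λ m → Walk G i j m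

Dist : ∀ {n} → SimpleGraph n → Fin n → Fin n → ℕ → Set
Dist G i j N = Walk G i j N × (∀ m → m ℕ.< N → ¬ Walk G i j m)

Closed : ∀ {n} → SimpleGraph n → Set
Closed G = ∀ {i j k} → Adj G j i → Adj G i k → j ≢ k →
           (i < j × i < k) ⊎ (j < i × k < i) → Adj G j k

-- L_N = { i | d(i,1) = N }, vertex 1 being the first element of Fin (suc m).
InLayer : ∀ {m} → SimpleGraph (ℕ.suc m) → ℕ → Fin (ℕ.suc m) → Set
InLayer G N i = Dist G i Fin.zero N

UpperNbr : ∀ {n} → SimpleGraph n → Fin n → Fin n → Set
UpperNbr G i j = Adj G i j × i < j

-- Induct on N, proving together that each layer L_N is a clique and that every vertex of
-- L_N has a smaller label than every vertex of L_{N+1}. Both steps apply closedness at a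
-- vertex whose two neighbours are both larger (or both smaller) than it, using that an
-- edge only joins vertices in the same or in consecutive layers. For (2), a vertex j of
-- L_{N+1} has a neighbour j' in L_N; either j' = d, or j' < d and closedness at j' joins d
-- to j. Conversely an upper neighbour j of d has distance at most N+1, and distance N or N-1
-- would contradict the maximality of d or the ordering of the layers.
module Submission where

open import Defs
open import Data.Nat using (ℕ; suc)
open import Data.Fin using (Fin; _≤_)
open import Data.Product using (_×_)
open import Relation.Binary.PropositionalEquality using (_≢_)
open import Function.Bundles using (_⇔_; mk⇔)

open import Data.Nat using (zero; s≤s)
import Data.Nat as ℕ
import Data.Nat.Properties as ℕ
open import Data.Nat.Induction using (<-rec)
import Data.Fin as Fin
import Data.Fin.Properties as Fin
open import Data.Product using (_,_; proj₁; proj₂; ∃-syntax)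
open import Data.Sum using (inj₁; inj₂)
open import Data.Empty using (⊥; ⊥-elim)
open import Function using (_∘_)
open import Relation.Nullary using (¬_; yes; no)
open import Relation.Nullary.Decidable using (¬¬-excluded-middle)
open import Relation.Binary.Definitions using (tri<; tri≈; tri>)
open import Relation.Binary.PropositionalEquality using (_≡_; refl; ≢-sym)

IsLeast : (ℕ → Set) → ℕ → Set
IsLeast P k = P k × (∀ m → m ℕ.< k → ¬ P m)

¬¬-least : (P : ℕ → Set) → ∀ {k} → P k → ¬ ¬ (∃[ k′ ] k′ ℕ.≤ k × IsLeast P k′)
¬¬-least P {k} = <-rec _ search k
  where
  search : ∀ k → (∀ {m} → m ℕ.< k → P m → ¬ ¬ (∃[ k′ ] k′ ℕ.≤ m × IsLeast P k′)) →
           P k → ¬ ¬ (∃[ k′ ] k′ ℕ.≤ k × IsLeast P k′)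
  search k rec pk ¬least = ¬¬-excluded-middle {A = ∃[ m ] m ℕ.< k × P m} λ
    { (yes (m , m<k , pm)) → rec m<k pm λ (k′ , k′≤m , least) →
        ¬least (k′ , ℕ.≤-trans k′≤m (ℕ.<⇒≤ m<k) , least)
    ; (no none) → ¬least (k , ℕ.≤-refl , pk , λ m m<k pm → none (m , m<k , pm)) }

module Layers {m} (G : SimpleGraph (suc m)) where

  layer-zero : ∀ {i} → InLayer G 0 i → i ≡ Fin.zero
  layer-zero (here , _) = refl

  layer-pred : ∀ {N i} → InLayer G (suc N) i → ∃[ i′ ] Adj G i i′ × InLayer G N i′
  layer-pred (step a w , minimal) =
    _ , a , w , λ k k<N w′ → minimal (suc k) (s≤s k<N) (step a w′)

  layer-unique : ∀ {N M i} → InLayer G N i → InLayer G M i → N ≡ M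
  layer-unique {N} {M} (wN , minN) (wM , minM) with ℕ.<-cmp N M
  ... | tri< N<M _ _ = ⊥-elim (minM N N<M wN)
  ... | tri≈ _ N≡M _ = N≡M
  ... | tri> _ _ M<N = ⊥-elim (minN M M<N wM)

  layers-disjoint : ∀ {N M i j} → InLayer G N i → InLayer G M j → N ≢ M → i ≢ j
  layers-disjoint li lj N≢M refl = N≢M (layer-unique li lj)

  adj⇒layer≤suc : ∀ {N M i j} → Adj G i j → InLayer G N j → InLayer G M i → M ℕ.≤ suc N
  adj⇒layer≤suc a (wj , _) (_ , minI) = ℕ.≮⇒≥ λ 1+N<M → minI _ 1+N<M (step a wj)

module ClosedLabeling {m} (G : SimpleGraph (suc m)) (closed : Closed G) where
  open Layers G

  closed-below : ∀ {i j k} → Adj G i j → Adj G i k → j ≢ k → i Fin.< j → i Fin.< k → Adj G j k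
  closed-below aij aik j≢k i<j i<k = closed (sym G aij) aik j≢k (inj₁ (i<j , i<k))

  closed-above : ∀ {i j k} → Adj G i j → Adj G i k → j ≢ k → j Fin.< i → k Fin.< i → Adj G j k
  closed-above aij aik j≢k j<i k<i = closed (sym G aij) aik j≢k (inj₂ (j<i , k<i))

  LayerIsClique : ℕ → Set
  LayerIsClique N = ∀ i j → InLayer G N i → InLayer G N j → i ≢ j → Adj G i j

  LayerPrecedesNext : ℕ → Set
  LayerPrecedesNext N = ∀ i j → InLayer G N i → InLayer G (suc N) j → i Fin.< j

  adj-via-smaller-pred : ∀ {N i j i′ j′} → LayerPrecedesNext N →
                         InLayer G (suc N) i → InLayer G (suc N) j → InLayer G N i′ → InLayer G N j′ →
                         Adj G i i′ → Adj G j j′ → Adj G i′ j′ → i′ Fin.< j′ → i ≢ j → Adj G i j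
  adj-via-smaller-pred {i = i} {j′ = j′} precedes li lj li′ lj′ ai aj ai′j′ i′<j′ i≢j =
    closed-below (sym G aij′) (sym G aj) i≢j (precedes _ _ lj′ li) (precedes _ _ lj′ lj)
    where
    aij′ : Adj G i j′
    aij′ = closed-below (sym G ai) ai′j′ (layers-disjoint li lj′ ℕ.1+n≢n)
                        (precedes _ _ li′ li) i′<j′

  clique-step : ∀ {N} → LayerIsClique N → LayerPrecedesNext N → LayerIsClique (suc N)
  clique-step clique precedes i j li lj i≢j with layer-pred li | layer-pred lj
  ... | i′ , ai , li′ | j′ , aj , lj′ with i′ Fin.≟ j′
  ...   | yes refl =
          closed-below (sym G ai) (sym G aj) i≢j (precedes i′ i li′ li) (precedes i′ j li′ lj)
  ...   | no i′≢j′ with Fin.<-cmp i′ j′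
  ...     | tri< i′<j′ _ _ =
            adj-via-smaller-pred precedes li lj li′ lj′ ai aj (clique i′ j′ li′ lj′ i′≢j′) i′<j′ i≢j
  ...     | tri≈ _ i′≡j′ _ = ⊥-elim (i′≢j′ i′≡j′)
  ...     | tri> _ _ j′<i′ = sym G (adj-via-smaller-pred precedes lj li lj′ li′ aj ai
                                       (clique j′ i′ lj′ li′ (≢-sym i′≢j′)) j′<i′ (≢-sym i≢j))

  precedes-step : ∀ {N} → LayerIsClique (suc N) → LayerPrecedesNext N → LayerPrecedesNext (suc N)
  precedes-step {N} clique precedes x y lx ly
    with layer-pred ly | layer-pred lx
  ... | y′ , ay , ly′ | w , aw , lw with layer-pred ly′
  ...   | z , ay′z , lz with Fin.<-cmp x y
  ...     | tri< x<y _ _ = x<y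
  ...     | tri≈ _ x≡y _ = ⊥-elim (layers-disjoint lx ly (≢-sym ℕ.1+n≢n) x≡y)
  ...     | tri> _ _ y<x =
            ⊥-elim (no-common-upper-neighbour (sym G ayx) aw lw y<x (precedes w x lw lx))
    where
    -- Closedness at u would join y ∈ L_{N+2} to t ∈ L_N.
    no-common-upper-neighbour : ∀ {u t} → Adj G u y → Adj G u t → InLayer G N t →
                                y Fin.< u → t Fin.< u → ⊥
    no-common-upper-neighbour {t = t} auy aut lt y<u t<u =
      ℕ.1+n≰n (adj⇒layer≤suc (closed-above auy aut y≢t y<u t<u) lt ly)
      where
      y≢t : y ≢ t
      y≢t = layers-disjoint ly lt (≢-sym (ℕ.m≢1+n+m N {1}))

    y′<y : y′ Fin.< y
    y′<y with Fin.<-cmp y′ y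
    ... | tri< y′<y _ _ = y′<y
    ... | tri≈ _ refl _ = ⊥-elim (irrefl G ay)
    ... | tri> _ _ y<y′ =
          ⊥-elim (no-common-upper-neighbour (sym G ay) ay′z lz y<y′ (precedes z y′ lz ly′))

    ayx : Adj G y x
    ayx = closed-below (sym G ay) (sym G (clique x y′ lx ly′ (≢-sym (Fin.<⇒≢ y′<x))))
                       (Fin.<⇒≢ y<x) y′<y y′<x
      where
      y′<x : y′ Fin.< x
      y′<x = Fin.<-trans y′<y y<x

  layer-zero-clique : LayerIsClique 0
  layer-zero-clique i j li lj i≢j with layer-zero li | layer-zero lj
  ... | refl | refl = ⊥-elim (i≢j refl)

  layer-zero-precedes : LayerPrecedesNext 0
  layer-zero-precedes i Fin.zero li (_ , minimal) = ⊥-elim (minimal 0 ℕ.z<s here)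
  layer-zero-precedes i (Fin.suc j) li lj with layer-zero li
  ... | refl = ℕ.z<s

  layer-clique×precedes : ∀ N → LayerIsClique N × LayerPrecedesNext N
  layer-clique×precedes zero = layer-zero-clique , layer-zero-precedes
  layer-clique×precedes (suc N) with layer-clique×precedes N
  ... | clique , precedes = clique′ , precedes-step clique′ precedes
    where
    clique′ : LayerIsClique (suc N)
    clique′ = clique-step clique precedes

  layer-clique : ∀ N → LayerIsClique N
  layer-clique = proj₁ ∘ layer-clique×precedes

  layer-precedes : ∀ N → LayerPrecedesNext N
  layer-precedes = proj₂ ∘ layer-clique×precedes

  next-layer⇔upper-neighbours : ∀ N d → InLayer G N d → (∀ i → InLayer G N i → i ≤ d) →
                                ∀ j → InLayer G (suc N) j ⇔ UpperNbr G d j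
  next-layer⇔upper-neighbours N d ld d-max j = mk⇔ to from
    where
    to : InLayer G (suc N) j → UpperNbr G d j
    to lj with layer-pred lj
    ... | j′ , aj , lj′ = adj-d-j , d<j
      where
      d<j : d Fin.< j
      d<j = layer-precedes N d j ld lj
      adj-d-j : Adj G d j
      adj-d-j with j′ Fin.≟ d
      ... | yes refl = sym G aj
      ... | no j′≢d = closed-below (layer-clique N j′ d lj′ ld j′≢d) (sym G aj)
                        (layers-disjoint ld lj (≢-sym ℕ.1+n≢n))
                        (Fin.≤∧≢⇒< (d-max j′ lj′) j′≢d) (layer-precedes N j′ j lj′ lj)

    -- A shorter walk would put j in some layer L_k with k ≤ N, while the edge to d forces
    -- N ≤ k + 1.
    from : UpperNbr G d j → InLayer G (suc N) j
    from (adj , d<j) = step (sym G adj) (proj₁ ld) , λ k k<1+N w →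
      ¬¬-least (λ k → Walk G j Fin.zero k) w λ (k′ , k′≤k , lk′) →
        not-in-layer-≤ k′ (ℕ.≤-trans k′≤k (ℕ.≤-pred k<1+N)) lk′
      where
      not-in-layer-≤ : ∀ k → k ℕ.≤ N → ¬ InLayer G k j
      not-in-layer-≤ k k≤N lk with ℕ.m≤n⇒m<n∨m≡n k≤N
      ... | inj₂ refl = ℕ.<⇒≱ d<j (d-max j lk)
      ... | inj₁ k<N with ℕ.≤-antisym k<N (adj⇒layer≤suc adj lk ld)
      ...   | refl = Fin.<-asym d<j (layer-precedes k j d lk ld)

proposition2p5 : ∀ {m} (G : SimpleGraph (suc m)) → Connected G → Closed G →
    (∀ (N : ℕ) (i j : Fin (suc m)) → InLayer G N i → InLayer G N j → i ≢ j → Adj G i j)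
    × (∀ (N : ℕ) (d : Fin (suc m)) → InLayer G N d → (∀ i → InLayer G N i → i ≤ d) →
         ∀ j → InLayer G (suc N) j ⇔ UpperNbr G d j)
proposition2p5 G _ closed = layer-clique , next-layer⇔upper-neighbours
  where open ClosedLabeling G closed
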